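{- Let $G$ be a connected graph of order $n\geqslant 3$ which is not a cycle. Then $$D'(G^{\frac{1}{2}})\leqslant \left\lceil \frac{ -1+\sqrt{1+8D'(G)}}{2}\right\rceil.$$
   Context: Graphs are finite and simple. $G^{\frac{1}{2}}$ is obtained from $G$ by replacing each edge $uv$ by a path $u\,w\,v$ of length 2 through a new vertex $w$. The distinguishing index $D'(H)$ is the least $d$ such that some edge labeling $E(H)\to\{1,\dots,d\}$ is preserved by no non-trivial automorphism of $H$. -}

module Defs where

open import Data.Nat using (ℕ; zero; suc; _*_; _≤_; _<_; _∸_)
open import Data.Fin using (Fin; toℕ)
import Data.Fin as F
open import Data.Fin.Properties using (_≟_)
open import Data.Bool using (Bool; true; false; _∨_)
open import Data.Sum using (_⊎_; inj₁; inj₂)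
open import Data.Product using (Σ; Σ-syntax; ∃; ∃-syntax; _×_; _,_; proj₁; proj₂)
open import Relation.Nullary using (¬_)
open import Relation.Nullary.Decidable using (⌊_⌋)
open import Relation.Binary.PropositionalEquality using (_≡_)
open import Function.Bundles using (_↔_; Inverse)
import Data.Nat.Properties as ℕP

record Graph : Set₁ where
  field
    V     : Set
    adj   : V → V → Bool
    sym   : ∀ u v → adj u v ≡ adj v u
    irref : ∀ v → adj v v ≡ false
open Graph public

record FinGraph (n : ℕ) : Set where
  field
    adj   : Fin n → Fin n → Bool
    sym   : ∀ u v → adj u v ≡ adj v u
    irref : ∀ v → adj v v ≡ false

toGraph : ∀ {n} → FinGraph n → Graph
toGraph {n} G = record { V = Fin n ; adj = FinGraph.adj G ; sym = FinGraph.sym G ; irref = FinGraph.irref G }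

Iso : Graph → Graph → Set
Iso G H = Σ[ f ∈ (V G ↔ V H) ] (∀ u v → adj H (Inverse.to f u) (Inverse.to f v) ≡ adj G u v)

Automorphism : Graph → Set
Automorphism G = Iso G G

-- Edge labelings with labels {1,…,d} (represented as Fin d): a function on ordered
-- pairs which is symmetric on edges; only its values on edges are relevant.
record EdgeLabeling (G : Graph) (d : ℕ) : Set where
  field
    lab : V G → V G → Fin d
    lab-sym : ∀ u v → adj G u v ≡ true → lab u v ≡ lab v u
open EdgeLabeling public

Preserves : (G : Graph) {d : ℕ} → Automorphism G → EdgeLabeling G d → Set
Preserves G (σ , _) ℓ = ∀ u v → adj G u v ≡ true →
  lab ℓ (Inverse.to σ u) (Inverse.to σ v) ≡ lab ℓ u v

Trivial : (G : Graph) → Automorphism G → Set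
Trivial G (σ , _) = ∀ v → Inverse.to σ v ≡ v

Distinguishing : (G : Graph) {d : ℕ} → EdgeLabeling G d → Set
Distinguishing G ℓ = ∀ (σ : Automorphism G) → Preserves G σ ℓ → Trivial G σ

DistinguishableWith : Graph → ℕ → Set
DistinguishableWith G d = Σ[ ℓ ∈ EdgeLabeling G d ] Distinguishing G ℓ

DistIndexIs : Graph → ℕ → Set
DistIndexIs G d = DistinguishableWith G d × (∀ j → j < d → ¬ DistinguishableWith G j)

DistIndexAtMost : Graph → ℕ → Set
DistIndexAtMost G k = Σ[ j ∈ ℕ ] (j ≤ k × DistinguishableWith G j)

data Walk {n : ℕ} (G : FinGraph n) : Fin n → Fin n → Set where
  here : ∀ {u} → Walk G u u
  step : ∀ {u v w} → FinGraph.adj G u v ≡ true → Walk G v w → Walk G u w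

Connected : ∀ {n} → FinGraph n → Set
Connected {n} G = ∀ (u v : Fin n) → Walk G u v

-- The cycle C_n on Fin n: i ~ j iff j = i+1 (mod n) or i = j+1 (mod n).
succMod : (n : ℕ) → Fin n → Fin n → Bool
succMod n i j = (⌊ toℕ j ℕP.≟ suc (toℕ i) ⌋)
              ∨ (⌊ toℕ i ℕP.≟ n ∸ 1 ⌋ Data.Bool.∧ ⌊ toℕ j ℕP.≟ 0 ⌋)
  where import Data.Bool

cycleAdj : (n : ℕ) → Fin n → Fin n → Bool
cycleAdj n i j = succMod n i j ∨ succMod n j i

IsCycle : ∀ {n} → FinGraph n → Set
IsCycle {n} G = Σ[ f ∈ (Fin n ↔ Fin n) ]
  (∀ u v → cycleAdj n (Inverse.to f u) (Inverse.to f v) ≡ FinGraph.adj G u v)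

-- The subdivision G^{1/2}: vertices are the original vertices plus one new vertex
-- for each edge {u,v} (represented once, as the pair with u < v).
SubEdge : ∀ {n} → FinGraph n → Set
SubEdge {n} G = Σ[ p ∈ Fin n × Fin n ] (FinGraph.adj G (proj₁ p) (proj₂ p) ≡ true × proj₁ p F.< proj₂ p)

private
  incident : ∀ {n} {G : FinGraph n} → Fin n → SubEdge G → Bool
  incident a ((u , v) , _) = ⌊ a ≟ u ⌋ ∨ ⌊ a ≟ v ⌋

  halfAdj : ∀ {n} (G : FinGraph n) → Fin n ⊎ SubEdge G → Fin n ⊎ SubEdge G → Bool
  halfAdj G (inj₁ a) (inj₁ b) = false
  halfAdj G (inj₁ a) (inj₂ e) = incident {G = G} a e
  halfAdj G (inj₂ e) (inj₁ a) = incident {G = G} a e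
  halfAdj G (inj₂ e) (inj₂ f) = false

  halfSym : ∀ {n} (G : FinGraph n) u v → halfAdj G u v ≡ halfAdj G v u
  halfSym G (inj₁ a) (inj₁ b) = Relation.Binary.PropositionalEquality.refl
  halfSym G (inj₁ a) (inj₂ e) = Relation.Binary.PropositionalEquality.refl
  halfSym G (inj₂ e) (inj₁ a) = Relation.Binary.PropositionalEquality.refl
  halfSym G (inj₂ e) (inj₂ f) = Relation.Binary.PropositionalEquality.refl

  halfIrr : ∀ {n} (G : FinGraph n) v → halfAdj G v v ≡ false
  halfIrr G (inj₁ a) = Relation.Binary.PropositionalEquality.refl
  halfIrr G (inj₂ e) = Relation.Binary.PropositionalEquality.refl

subdivide : ∀ {n} → FinGraph n → Graph
subdivide {n} G = record
  { V = Fin n ⊎ SubEdge G ; adj = halfAdj G ; sym = halfSym G ; irref = halfIrr G }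

-- ⌈(-1 + √(1+8d))/2⌉ = the least k ∈ ℕ with d ≤ k(k+1)/2, i.e. 2d ≤ k(k+1).
IsCeilTri : ℕ → ℕ → Set
IsCeilTri d k = (2 * d ≤ k * suc k) × (∀ j → j < k → ¬ (2 * d ≤ j * suc j))

{-# OPTIONS --safe #-}
-- Take a distinguishing edge labelling ℓ of G with d labels. As 2d ≤ k(k+1), the labels can be coded
-- injectively by unordered pairs {a, b} of labels in {1, …, k}; the two halves of the subdivided
-- edge uv receive a and b. Because G is connected and not a cycle, no automorphism of G^{1/2} sends
-- an original vertex to a subdivision vertex: by connectivity and bipartiteness all original vertices
-- would go there, so each would have exactly two neighbours, and a connected 2-regular graph is a
-- cycle. So an automorphism of G^{1/2} restricts to an automorphism of G, which keeps the unordered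
-- pair on every edge, hence preserves ℓ, hence is trivial; and then so is the automorphism itself.
module Submission where

open import Defs hiding (sym)
open import Axiom.UniquenessOfIdentityProofs using (module Decidable⇒UIP)
open import Data.Bool using (Bool; true; false; _∨_; _∧_; not)
import Data.Bool.Properties as Bool
open import Data.Empty using (⊥; ⊥-elim)
open import Data.Fin as Fin using (Fin; toℕ; fromℕ<)
import Data.Fin.Properties as Fin
open import Data.Nat using (ℕ; zero; suc; _+_; _*_; _∸_; _<_; _≤_; z≤n; s≤s)
open import Data.Nat.Induction using (<-wellFounded)
open import Data.Nat.Properties as ℕ using (_<?_)
open import Data.Product using (Σ-syntax; ∃-syntax; _×_; _,_; proj₁; proj₂; swap)
open import Data.Sum using (_⊎_; inj₁; inj₂)
import Data.Sum.Properties as Sum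
open import Function using (_∘_)
open import Function.Bundles using (_↔_; Inverse; mk↔ₛ′)
open import Function.Properties.Inverse using (↔-sym)
open import Induction.WellFounded using (Acc; acc)
open import Relation.Binary.Definitions using (DecidableEquality; tri<; tri≈; tri>)
open import Relation.Binary.PropositionalEquality
open import Relation.Nullary using (¬_; yes; no)
open import Relation.Nullary.Decidable using (Dec; ⌊_⌋; dec-true; isYes≗does)

∨-true-split : ∀ a {b} → a ∨ b ≡ true → a ≡ true ⊎ b ≡ true
∨-true-split true  _ = inj₁ refl
∨-true-split false p = inj₂ p

∨-true-introˡ : ∀ {a} b → a ≡ true → a ∨ b ≡ true
∨-true-introˡ b refl = refl

∨-true-introʳ : ∀ a {b} → b ≡ true → a ∨ b ≡ true
∨-true-introʳ true  _ = refl
∨-true-introʳ false p = p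

∧-true-intro : ∀ {a b} → a ≡ true → b ≡ true → a ∧ b ≡ true
∧-true-intro refl refl = refl

true⇔true⇒≡ : ∀ {a b} → (a ≡ true → b ≡ true) → (b ≡ true → a ≡ true) → a ≡ b
true⇔true⇒≡ {true}           a⇒b _ = sym (a⇒b refl)
true⇔true⇒≡ {false} {false} _   _ = refl
true⇔true⇒≡ {false} {true}  _ b⇒a = b⇒a refl

⌊⌋-true : ∀ {p} {P : Set p} (P? : Dec P) → P → ⌊ P? ⌋ ≡ true
⌊⌋-true P? p = trans (isYes≗does P?) (dec-true P? p)

InjectiveBelow : ∀ {a} {A : Set a} → ℕ → (ℕ → A) → Set a
InjectiveBelow P f = ∀ {i j} → i < P → j < P → f i ≡ f j → i ≡ j

RepeatAt : ∀ {a} {A : Set a} → (ℕ → A) → ℕ → Set a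
RepeatAt f m = ∃[ i ] (i < m × f i ≡ f m)

earliest-repeat : ∀ {a} {A : Set a} → DecidableEquality A → (f : ℕ → A) → ∀ m → RepeatAt f m →
                  Σ[ P ∈ ℕ ] (RepeatAt f P × InjectiveBelow P f)
earliest-repeat _≟_ f m = go m (<-wellFounded m)
  where
  go : ∀ m → Acc _<_ m → RepeatAt f m → Σ[ P ∈ ℕ ] (RepeatAt f P × InjectiveBelow P f)
  go m (acc rs) r with ℕ.anyUpTo? (λ j → ℕ.anyUpTo? (λ i → f i ≟ f j) j) m
  ... | yes (j , j<m , rⱼ) = go j (rs j<m) rⱼ
  ... | no none = m , r , injective
    where
    injective : InjectiveBelow m f
    injective {i} {j} i<m j<m fi≡fj with ℕ.<-cmp i j
    ... | tri< i<j _ _ = ⊥-elim (none (j , j<m , i , i<j , fi≡fj))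
    ... | tri≈ _ i≡j _ = i≡j
    ... | tri> _ _ j<i = ⊥-elim (none (i , i<m , j , j<i , sym fi≡fj))

first-repeat : ∀ {n} (f : ℕ → Fin n) → Σ[ P ∈ ℕ ] (RepeatAt f P × InjectiveBelow P f)
first-repeat {n} f with Fin.pigeonhole (ℕ.n<1+n n) (f ∘ toℕ)
... | i , j , i<j , fi≡fj = earliest-repeat Fin._≟_ f (toℕ j) (toℕ i , i<j , fi≡fj)

SamePair : ∀ {a} {A : Set a} → A × A → A × A → Set a
SamePair p q = p ≡ q ⊎ p ≡ swap q

SamePair-sym : ∀ {a} {A : Set a} {p q : A × A} → SamePair p q → SamePair q p
SamePair-sym (inj₁ refl) = inj₁ refl
SamePair-sym (inj₂ refl) = inj₂ refl

SamePair-trans : ∀ {a} {A : Set a} {p q r : A × A} → SamePair p q → SamePair q r → SamePair p r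
SamePair-trans (inj₁ refl) q≈r         = q≈r
SamePair-trans (inj₂ refl) (inj₁ refl) = inj₂ refl
SamePair-trans (inj₂ refl) (inj₂ refl) = inj₁ refl

SamePair-map : ∀ {a b} {A : Set a} {B : Set b} (f : A → B) {p q : A × A} →
               SamePair p q → SamePair (Data.Product.map f f p) (Data.Product.map f f q)
SamePair-map f (inj₁ refl) = inj₁ refl
SamePair-map f (inj₂ refl) = inj₂ refl

Ordered : ℕ × ℕ → Set
Ordered (a , b) = a ≤ b

SamePair-ordered⇒≡ : ∀ {p q} → Ordered p → Ordered q → SamePair p q → p ≡ q
SamePair-ordered⇒≡ _ _ (inj₁ p≡q) = p≡q
SamePair-ordered⇒≡ {a , b} {c , d} a≤b c≤d (inj₂ refl) = cong₂ _,_ a≡c (sym a≡c)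
  where
  a≡c : a ≡ c
  a≡c = ℕ.≤-antisym a≤b c≤d

triangle : ℕ → ℕ
triangle zero    = zero
triangle (suc b) = suc b + triangle b

2*triangle : ∀ b → 2 * triangle b ≡ b * suc b
2*triangle zero    = refl
2*triangle (suc b) = begin
  2 * (suc b + triangle b)       ≡⟨ ℕ.*-distribˡ-+ 2 (suc b) (triangle b) ⟩
  2 * suc b + 2 * triangle b     ≡⟨ cong (2 * suc b +_) (2*triangle b) ⟩
  2 * suc b + b * suc b          ≡⟨ ℕ.*-distribʳ-+ (suc b) 2 b ⟨
  suc (suc b) * suc b            ≡⟨ ℕ.*-comm (suc (suc b)) (suc b) ⟩
  suc b * suc (suc b)            ∎
  where open ≡-Reasoning

-- Lists the pairs a ≤ b as (0,0), (0,1), (1,1), (0,2), (1,2), (2,2), (0,3), …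
nextPair : ℕ × ℕ → ℕ × ℕ
nextPair (a , b) with a <? b
... | yes _ = suc a , b
... | no  _ = zero , suc b

unrank : ℕ → ℕ × ℕ
unrank zero    = zero , zero
unrank (suc t) = nextPair (unrank t)

Ranked : ℕ → ℕ × ℕ → Set
Ranked t (a , b) = a ≤ b × triangle b + a ≡ t

nextPair-ranked : ∀ {t} p → Ranked t p → Ranked (suc t) (nextPair p)
nextPair-ranked (a , b) (a≤b , tb+a≡t) with a <? b
... | yes a<b = a<b , trans (ℕ.+-suc (triangle b) a) (cong suc tb+a≡t)
... | no  a≮b = z≤n , (begin
  triangle (suc b) + 0     ≡⟨ ℕ.+-identityʳ _ ⟩
  suc (b + triangle b)     ≡⟨ cong suc (ℕ.+-comm b (triangle b)) ⟩
  suc (triangle b + b)     ≡⟨ cong (λ c → suc (triangle b + c)) (ℕ.≤-antisym a≤b (ℕ.≮⇒≥ a≮b)) ⟨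
  suc (triangle b + a)     ≡⟨ cong suc tb+a≡t ⟩
  suc _                    ∎)
  where open ≡-Reasoning

unrank-ranked : ∀ t → Ranked t (unrank t)
unrank-ranked zero    = z≤n , refl
unrank-ranked (suc t) = nextPair-ranked (unrank t) (unrank-ranked t)

unrank-ordered : ∀ t → Ordered (unrank t)
unrank-ordered t = proj₁ (unrank-ranked t)

unrank-injective : ∀ {s t} → unrank s ≡ unrank t → s ≡ t
unrank-injective {s} {t} eq = begin
  s                                                   ≡⟨ proj₂ (unrank-ranked s) ⟨
  triangle (proj₂ (unrank s)) + proj₁ (unrank s)      ≡⟨ cong (λ p → triangle (proj₂ p) + proj₁ p) eq ⟩
  triangle (proj₂ (unrank t)) + proj₁ (unrank t)      ≡⟨ proj₂ (unrank-ranked t) ⟩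
  t                                                   ∎
  where open ≡-Reasoning

unrank-bounded : ∀ {t k} → 2 * t < k * suc k → proj₂ (unrank t) < k
unrank-bounded {t} {k} 2t<k[k+1] = ℕ.≰⇒> λ k≤b → ℕ.<⇒≱ 2t<k[k+1] (begin
  k * suc k                ≤⟨ ℕ.*-mono-≤ k≤b (s≤s k≤b) ⟩
  b * suc b                ≡⟨ 2*triangle b ⟨
  2 * triangle b           ≤⟨ ℕ.*-monoʳ-≤ 2 (ℕ.m≤m+n (triangle b) a) ⟩
  2 * (triangle b + a)     ≡⟨ cong (2 *_) (proj₂ (unrank-ranked t)) ⟩
  2 * t                    ∎)
  where
  open ℕ.≤-Reasoning
  a b : ℕ
  a = proj₁ (unrank t)
  b = proj₂ (unrank t)

module PairCode {d k : ℕ} (2d≤k[k+1] : 2 * d ≤ k * suc k) where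

  snd<k : (i : Fin d) → proj₂ (unrank (toℕ i)) < k
  snd<k i = unrank-bounded {toℕ i} (ℕ.<-≤-trans (ℕ.*-monoʳ-< 2 (Fin.toℕ<n i)) 2d≤k[k+1])

  pairCode : Fin d → Fin k × Fin k
  pairCode i = fromℕ< (ℕ.≤-<-trans (unrank-ordered (toℕ i)) (snd<k i)) , fromℕ< (snd<k i)

  toℕ-pairCode : ∀ i → Data.Product.map toℕ toℕ (pairCode i) ≡ unrank (toℕ i)
  toℕ-pairCode i = cong₂ _,_ (Fin.toℕ-fromℕ< _) (Fin.toℕ-fromℕ< _)

  pairCode-injective : ∀ {i j} → SamePair (pairCode i) (pairCode j) → i ≡ j
  pairCode-injective {i} {j} same = Fin.toℕ-injective (unrank-injective
    (SamePair-ordered⇒≡ (unrank-ordered (toℕ i)) (unrank-ordered (toℕ j))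
      (subst₂ SamePair (toℕ-pairCode i) (toℕ-pairCode j) (SamePair-map toℕ same))))

adj⇒≢ : ∀ (G : Graph) {x y} → adj G x y ≡ true → x ≢ y
adj⇒≢ G {x} xy refl with trans (sym xy) (irref G x)
... | ()

adj-sym : ∀ (G : Graph) {x y} → adj G x y ≡ true → adj G y x ≡ true
adj-sym G {x} {y} xy = trans (Graph.sym G y x) xy

Iso-sym : ∀ {G H : Graph} → Iso G H → Iso H G
Iso-sym {G} {H} (σ , pres) = ↔-sym σ , λ u w →
  trans (sym (pres (from u) (from w))) (cong₂ (adj H) (Inverse.strictlyInverseˡ σ u) (Inverse.strictlyInverseˡ σ w))
  where open Inverse σ using (from)

record TwoNeighbours (G : Graph) (w : V G) : Set where
  field
    left right : V G
    left≢right : left ≢ right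
    adj-left   : adj G w left ≡ true
    adj-right  : adj G w right ≡ true
    only       : ∀ c → adj G w c ≡ true → c ≡ left ⊎ c ≡ right

Iso-reflects-TwoNeighbours : ∀ {G H : Graph} (σ : Iso G H) {w} →
                             TwoNeighbours H (Inverse.to (proj₁ σ) w) → TwoNeighbours G w
Iso-reflects-TwoNeighbours {G} {H} (σ , pres) {w} t = record
  { left       = from left
  ; right      = from right
  ; left≢right = λ eq → left≢right (trans (sym (to∘from left)) (trans (cong to eq) (to∘from right)))
  ; adj-left   = trans (sym (pres-from left)) adj-left
  ; adj-right  = trans (sym (pres-from right)) adj-right
  ; only       = λ c wc → Data.Sum.map (pull c) (pull c) (only (to c) (trans (pres w c) wc))
  }
  where
  open TwoNeighbours t
  open Inverse σ using (to; from)
  to∘from : ∀ p → to (from p) ≡ p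
  to∘from = Inverse.strictlyInverseˡ σ
  pres-from : ∀ p → adj H (to w) p ≡ adj G w (from p)
  pres-from p = trans (cong (adj H (to w)) (sym (to∘from p))) (pres w (from p))
  pull : ∀ c {p} → to c ≡ p → c ≡ from p
  pull c refl = sym (Inverse.strictlyInverseʳ σ c)

SuccMod : ℕ → ℕ → ℕ → Set
SuccMod n a b = b ≡ suc a ⊎ (a ≡ n ∸ 1 × b ≡ 0)

succMod-sound : ∀ n (i j : Fin n) → succMod n i j ≡ true → SuccMod n (toℕ i) (toℕ j)
succMod-sound n i j s with toℕ j ℕ.≟ suc (toℕ i) | toℕ i ℕ.≟ n ∸ 1 | toℕ j ℕ.≟ 0
... | yes j≡i+1 | _          | _        = inj₁ j≡i+1
... | no  _     | yes i≡last | yes j≡0  = inj₂ (i≡last , j≡0)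
succMod-sound n i j () | no _ | yes _ | no _
succMod-sound n i j () | no _ | no _  | _

succMod-complete : ∀ n (i j : Fin n) → SuccMod n (toℕ i) (toℕ j) → succMod n i j ≡ true
succMod-complete n i j (inj₁ j≡i+1) = ∨-true-introˡ _ (⌊⌋-true (toℕ j ℕ.≟ suc (toℕ i)) j≡i+1)
succMod-complete n i j (inj₂ (i≡last , j≡0)) = ∨-true-introʳ ⌊ toℕ j ℕ.≟ suc (toℕ i) ⌋
  (∧-true-intro (⌊⌋-true (toℕ i ℕ.≟ n ∸ 1) i≡last) (⌊⌋-true (toℕ j ℕ.≟ 0) j≡0))

record CyclicEnumeration {n} (G : FinGraph n) (P : ℕ) (v : ℕ → Fin n) : Set where
  field
    adj-step        : ∀ i → FinGraph.adj G (v i) (v (suc i)) ≡ true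
    closes          : v P ≡ v 0
    injective       : InjectiveBelow P v
    surjective      : ∀ y → ∃[ j ] (j < P × v j ≡ y)
    neighbours-suc  : ∀ i y → FinGraph.adj G (v (suc i)) y ≡ true → y ≡ v i ⊎ y ≡ v (suc (suc i))
    neighbours-zero : ∀ y → FinGraph.adj G (v 0) y ≡ true → y ≡ v 1 ⊎ y ≡ v (P ∸ 1)

module _ {n} {G : FinGraph n} {P} {v : ℕ → Fin n} (E : CyclicEnumeration G P v) where
  open CyclicEnumeration E

  position : Fin n → Fin P
  position y = fromℕ< (proj₁ (proj₂ (surjective y)))

  v-position : ∀ y → v (toℕ (position y)) ≡ y
  v-position y = trans (cong v (Fin.toℕ-fromℕ< _)) (proj₂ (proj₂ (surjective y)))

  position-injective : ∀ {y y'} → position y ≡ position y' → y ≡ y'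
  position-injective {y} {y'} eq = trans (sym (v-position y)) (trans (cong (v ∘ toℕ) eq) (v-position y'))

  enumeration-length : P ≡ n
  enumeration-length = Fin.cantor-schröder-bernstein {f = v ∘ toℕ} {g = position}
    (λ eq → Fin.toℕ-injective (injective (Fin.toℕ<n _) (Fin.toℕ<n _) eq)) position-injective

module _ {n} {G : FinGraph n} {v : ℕ → Fin n} (E : CyclicEnumeration G n v) (1<n : 1 < n) where
  open CyclicEnumeration E

  private
    A : Fin n → Fin n → Bool
    A = FinGraph.adj G

    last<n : n ∸ 1 < n
    last<n = ℕ.∸-monoʳ-< {o = 0} (s≤s z≤n) (ℕ.<⇒≤ 1<n)

  SuccMod⇒adj : ∀ {a b} → SuccMod n a b → A (v a) (v b) ≡ true
  SuccMod⇒adj {a} (inj₁ refl) = adj-step a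
  SuccMod⇒adj (inj₂ (refl , refl)) =
    subst (λ y → A (v (n ∸ 1)) y ≡ true) (trans (cong v (ℕ.m+[n∸m]≡n (ℕ.<⇒≤ 1<n))) closes) (adj-step (n ∸ 1))

  adj⇒SuccMod : ∀ {a b} → a < n → b < n → A (v a) (v b) ≡ true → SuccMod n a b ⊎ SuccMod n b a
  adj⇒SuccMod {zero} {b} _ b<n ab with neighbours-zero (v b) ab
  ... | inj₁ vb≡v1   = inj₁ (inj₁ (injective b<n 1<n vb≡v1))
  ... | inj₂ vb≡last = inj₂ (inj₂ (injective b<n last<n vb≡last , refl))
  adj⇒SuccMod {suc a} {b} a<n b<n ab with neighbours-suc a (v b) ab
  ... | inj₁ vb≡va = inj₂ (inj₁ (cong suc (injective (ℕ.<-trans (ℕ.n<1+n a) a<n) b<n (sym vb≡va))))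
  ... | inj₂ vb≡va+2 with ℕ.m≤n⇒m<n∨m≡n a<n
  ...   | inj₁ a+2<n = inj₁ (inj₁ (injective b<n a+2<n vb≡va+2))
  ...   | inj₂ a+2≡n = inj₁ (inj₂ (cong (_∸ 1) a+2≡n ,
                         injective b<n (ℕ.<-trans (s≤s z≤n) 1<n) (trans vb≡va+2 (trans (cong v a+2≡n) closes))))

  enumeration⇒cycle : IsCycle G
  enumeration⇒cycle = mk↔ₛ′ (position E) vertex position∘vertex (v-position E) ,
                      λ u w → trans (cycleAdj≡adj _ _) (cong₂ A (v-position E u) (v-position E w))
    where
    vertex : Fin n → Fin n
    vertex i = v (toℕ i)
    position∘vertex : ∀ i → position E (vertex i) ≡ i
    position∘vertex i = Fin.toℕ-injective
      (injective (Fin.toℕ<n (position E (vertex i))) (Fin.toℕ<n i) (v-position E (vertex i)))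
    cycleAdj≡adj : ∀ i j → cycleAdj n i j ≡ A (vertex i) (vertex j)
    cycleAdj≡adj i j = true⇔true⇒≡ cyc⇒adj adj⇒cyc
      where
      cyc⇒adj : cycleAdj n i j ≡ true → A (vertex i) (vertex j) ≡ true
      cyc⇒adj c with ∨-true-split (succMod n i j) c
      ... | inj₁ i→j = SuccMod⇒adj (succMod-sound n i j i→j)
      ... | inj₂ j→i = adj-sym (toGraph G) (SuccMod⇒adj (succMod-sound n j i j→i))
      adj⇒cyc : A (vertex i) (vertex j) ≡ true → cycleAdj n i j ≡ true
      adj⇒cyc a with adj⇒SuccMod (Fin.toℕ<n i) (Fin.toℕ<n j) a
      ... | inj₁ i→j = ∨-true-introˡ _ (succMod-complete n i j i→j)
      ... | inj₂ j→i = ∨-true-introʳ (succMod n i j) (succMod-complete n j i j→i)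

module TwoRegular {n} (G : FinGraph n) (two : ∀ x → TwoNeighbours (toGraph G) x) where
  open TwoNeighbours

  private
    A : Fin n → Fin n → Bool
    A = FinGraph.adj G

  other : Fin n → Fin n → Fin n
  other p c with p Fin.≟ left (two c)
  ... | yes _ = right (two c)
  ... | no  _ = left (two c)

  other-spec : ∀ {p c} → A c p ≡ true →
               other p c ≢ p × A c (other p c) ≡ true × (∀ y → A c y ≡ true → y ≡ p ⊎ y ≡ other p c)
  other-spec {p} {c} cp with p Fin.≟ left (two c)
  ... | yes refl = left≢right (two c) ∘ sym , adj-right (two c) , only (two c)
  ... | no p≢l with only (two c) p cp
  ...   | inj₁ p≡l  = ⊥-elim (p≢l p≡l)
  ...   | inj₂ refl = left≢right (two c) , adj-left (two c) , λ y cy → Data.Sum.swap (only (two c) y cy)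

  module Tour (conn : Connected G) (x₀ : Fin n) where

    -- The walk from x₀ that never turns back; in a 2-regular graph it has no choices.
    edgeAt : ℕ → Fin n × Fin n
    edgeAt zero    = x₀ , left (two x₀)
    edgeAt (suc i) = proj₂ (edgeAt i) , other (proj₁ (edgeAt i)) (proj₂ (edgeAt i))

    v : ℕ → Fin n
    v i = proj₁ (edgeAt i)

    v-adj : ∀ i → A (v i) (v (suc i)) ≡ true
    v-adj zero    = adj-left (two x₀)
    v-adj (suc i) = proj₁ (proj₂ (other-spec (adj-sym (toGraph G) (v-adj i))))

    v-no-backtrack : ∀ i → v (suc (suc i)) ≢ v i
    v-no-backtrack i = proj₁ (other-spec (adj-sym (toGraph G) (v-adj i)))

    v-neighbours : ∀ i y → A (v (suc i)) y ≡ true → y ≡ v i ⊎ y ≡ v (suc (suc i))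
    v-neighbours i = proj₂ (proj₂ (other-spec (adj-sym (toGraph G) (v-adj i))))

    -- A first repeat v P = v (suc i) would give v (suc i) a third neighbour v P' besides v i and v (i + 2).
    first-repeat-returns : ∀ {i P} → i < P → v i ≡ v P → InjectiveBelow P v → i ≡ 0
    first-repeat-returns {zero} _ _ _ = refl
    first-repeat-returns {suc i} {suc P'} (s≤s i<P') vi+1≡vP injective
      with v-neighbours i (v P') (subst (λ x → A x (v P') ≡ true) (sym vi+1≡vP) (adj-sym (toGraph G) (v-adj P')))
    ... | inj₁ vP'≡vi = ⊥-elim (ℕ.<-irrefl (sym P'≡i) i<P')
      where
      P'≡i : P' ≡ i
      P'≡i = injective (ℕ.n<1+n P') (ℕ.<-trans (ℕ.n<1+n i) (s≤s i<P')) vP'≡vi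
    ... | inj₂ vP'≡vi+2 with ℕ.m≤n⇒m<n∨m≡n i<P'
    ...   | inj₁ i+1<P' = ⊥-elim (v-no-backtrack (suc i) (sym (trans vi+1≡vP (cong (v ∘ suc) P'≡i+2))))
      where
      P'≡i+2 : P' ≡ suc (suc i)
      P'≡i+2 = injective (ℕ.n<1+n P') (s≤s i+1<P') vP'≡vi+2
    ...   | inj₂ i+1≡P' = ⊥-elim (adj⇒≢ (toGraph G) (v-adj P') (trans vP'≡vi+2 (cong (v ∘ suc) i+1≡P')))

    returns-late : ∀ {m} → 0 < m → v m ≡ v 0 → 3 ≤ m
    returns-late {1} _ v1≡v0 = ⊥-elim (adj⇒≢ (toGraph G) (v-adj 0) (sym v1≡v0))
    returns-late {2} _ v2≡v0 = ⊥-elim (v-no-backtrack 0 v2≡v0)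
    returns-late {suc (suc (suc _))} _ _ = s≤s (s≤s (s≤s z≤n))

    P : ℕ
    P = proj₁ (first-repeat v)

    injective : InjectiveBelow P v
    injective = proj₂ (proj₂ (first-repeat v))

    0<P : 0 < P
    0<P with proj₁ (proj₂ (first-repeat v))
    ... | _ , i<P , _ = ℕ.≤-<-trans z≤n i<P

    closes : v P ≡ v 0
    closes with proj₁ (proj₂ (first-repeat v))
    ... | i , i<P , vi≡vP with first-repeat-returns i<P vi≡vP injective
    ...   | refl = sym vi≡vP

    3≤P : 3 ≤ P
    3≤P = returns-late 0<P closes

    1<P : 1 < P
    1<P = ℕ.<-≤-trans (s≤s (s≤s z≤n)) 3≤P

    P∸1+1≡P : suc (P ∸ 1) ≡ P
    P∸1+1≡P = ℕ.m+[n∸m]≡n 0<P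

    P∸1<P : P ∸ 1 < P
    P∸1<P = subst (P ∸ 1 <_) P∸1+1≡P (ℕ.n<1+n (P ∸ 1))

    x₀~last : A x₀ (v (P ∸ 1)) ≡ true
    x₀~last = adj-sym (toGraph G) (subst (λ x → A (v (P ∸ 1)) x ≡ true) (trans (cong v P∸1+1≡P) closes) (v-adj (P ∸ 1)))

    last-is-right : v (P ∸ 1) ≡ right (two x₀)
    last-is-right with only (two x₀) (v (P ∸ 1)) x₀~last
    ... | inj₂ last≡right = last≡right
    ... | inj₁ last≡v1 = ⊥-elim (ℕ.<-irrefl (sym (injective P∸1<P 1<P last≡v1))
                                            (ℕ.≤-trans (s≤s (s≤s z≤n)) (ℕ.∸-monoˡ-≤ 1 3≤P)))

    neighbours-zero : ∀ y → A (v 0) y ≡ true → y ≡ v 1 ⊎ y ≡ v (P ∸ 1)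
    neighbours-zero y x₀~y = Data.Sum.map₂ (λ y≡right → trans y≡right (sym last-is-right)) (only (two x₀) y x₀~y)

    OnTour : Fin n → Set
    OnTour y = ∃[ j ] (j < P × v j ≡ y)

    OnTour-closed : ∀ {i} y → i < P → A (v i) y ≡ true → OnTour y
    OnTour-closed {zero} y _ vi~y with neighbours-zero y vi~y
    ... | inj₁ y≡v1   = 1 , 1<P , sym y≡v1
    ... | inj₂ y≡last = P ∸ 1 , P∸1<P , sym y≡last
    OnTour-closed {suc i} y i+1<P vi~y with v-neighbours i y vi~y
    ... | inj₁ y≡vi = i , ℕ.<-trans (ℕ.n<1+n i) i+1<P , sym y≡vi
    ... | inj₂ y≡vi+2 with ℕ.m≤n⇒m<n∨m≡n i+1<P
    ...   | inj₁ i+2<P = suc (suc i) , i+2<P , sym y≡vi+2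
    ...   | inj₂ i+2≡P = 0 , 0<P , sym (trans y≡vi+2 (trans (cong v i+2≡P) closes))

    OnTour-walk : ∀ {x y} → Walk G x y → OnTour x → OnTour y
    OnTour-walk here          on = on
    OnTour-walk (step x~w wk) (j , j<P , refl) = OnTour-walk wk (OnTour-closed _ j<P x~w)

    enumeration : CyclicEnumeration G P v
    enumeration = record
      { adj-step        = v-adj
      ; closes          = closes
      ; injective       = injective
      ; surjective      = λ y → OnTour-walk (conn x₀ y) (0 , 0<P , refl)
      ; neighbours-suc  = v-neighbours
      ; neighbours-zero = neighbours-zero
      }

connected-two-regular⇒cycle : ∀ {n} (G : FinGraph n) → Fin n → Connected G →
                              (∀ x → TwoNeighbours (toGraph G) x) → IsCycle G
connected-two-regular⇒cycle {n} G x₀ conn two =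
  enumeration⇒cycle (subst (λ m → CyclicEnumeration G m v) P≡n enumeration) (subst (1 <_) P≡n 1<P)
  where
  open TwoRegular.Tour G two conn x₀
  P≡n : P ≡ n
  P≡n = enumeration-length enumeration

module Subdivision {n} (G : FinGraph n) where

  H : Graph
  H = subdivide G

  private
    A : Fin n → Fin n → Bool
    A = FinGraph.adj G

  Incident : Fin n → SubEdge G → Set
  Incident x ((u , w) , _) = x ≡ u ⊎ x ≡ w

  incident⇒adj : ∀ {x} e → Incident x e → adj H (inj₁ x) (inj₂ e) ≡ true
  incident⇒adj {x} ((u , w) , _) (inj₁ x≡u) = ∨-true-introˡ _ (⌊⌋-true (x Fin.≟ u) x≡u)
  incident⇒adj {x} ((u , w) , _) (inj₂ x≡w) = ∨-true-introʳ ⌊ x Fin.≟ u ⌋ (⌊⌋-true (x Fin.≟ w) x≡w)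

  adj⇒incident : ∀ {x} e → adj H (inj₁ x) (inj₂ e) ≡ true → Incident x e
  adj⇒incident {x} ((u , w) , _) x~e with x Fin.≟ u | x Fin.≟ w
  ... | yes x≡u | _       = inj₁ x≡u
  ... | no  _   | yes x≡w = inj₂ x≡w
  adj⇒incident ((u , w) , _) () | no _ | no _

  neighbour-of-original : ∀ {x w} → adj H (inj₁ x) w ≡ true → Σ[ e ∈ SubEdge G ] (w ≡ inj₂ e × Incident x e)
  neighbour-of-original {w = inj₂ e} x~e = e , refl , adj⇒incident e x~e

  incident-pair : ∀ e {x y} → x ≢ y → Incident x e → Incident y e → SamePair (x , y) (proj₁ e)
  incident-pair e x≢y (inj₁ refl) (inj₁ refl) = ⊥-elim (x≢y refl)
  incident-pair e _   (inj₁ refl) (inj₂ refl) = inj₁ refl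
  incident-pair e _   (inj₂ refl) (inj₁ refl) = inj₂ refl
  incident-pair e x≢y (inj₂ refl) (inj₂ refl) = ⊥-elim (x≢y refl)

  SubEdge-≡ : ∀ {e e' : SubEdge G} → SamePair (proj₁ e) (proj₁ e') → e ≡ e'
  SubEdge-≡ {(u , w) , uw , u<w} {_ , uw' , u<w'} (inj₁ refl) =
    cong₂ (λ p q → (u , w) , p , q) (Decidable⇒UIP.≡-irrelevant Bool._≟_ uw uw') (Fin.<-irrelevant u<w u<w')
  SubEdge-≡ {(u , w) , _ , u<w} {_ , _ , w<u} (inj₂ refl) = ⊥-elim (Fin.<-asym u<w w<u)

  shared-endpoints⇒≡ : ∀ {x y} e e' → x ≢ y → Incident x e → Incident y e → Incident x e' → Incident y e' → e ≡ e'
  shared-endpoints⇒≡ e e' x≢y xe ye xe' ye' =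
    SubEdge-≡ (SamePair-trans (SamePair-sym (incident-pair e x≢y xe ye)) (incident-pair e' x≢y xe' ye'))

  edgeThrough : ∀ {u w} → A u w ≡ true → Σ[ e ∈ SubEdge G ] (Incident u e × Incident w e)
  edgeThrough {u} {w} uw with Fin.<-cmp u w
  ... | tri< u<w _ _ = ((u , w) , uw , u<w) , inj₁ refl , inj₂ refl
  ... | tri≈ _ u≡w _ = ⊥-elim (adj⇒≢ (toGraph G) uw u≡w)
  ... | tri> _ _ w<u = ((w , u) , adj-sym (toGraph G) uw , w<u) , inj₂ refl , inj₁ refl

  incident⇒adjacent : ∀ {x y} e → x ≢ y → Incident x e → Incident y e → A x y ≡ true
  incident⇒adjacent e@(_ , uw , _) x≢y xe ye with incident-pair e x≢y xe ye
  ... | inj₁ refl = uw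
  ... | inj₂ refl = adj-sym (toGraph G) uw

  otherEnd : ∀ {x} e → Incident x e → Fin n
  otherEnd ((u , w) , _) (inj₁ _) = w
  otherEnd ((u , w) , _) (inj₂ _) = u

  otherEnd-incident : ∀ {x} e (xe : Incident x e) → Incident (otherEnd e xe) e
  otherEnd-incident _ (inj₁ _) = inj₂ refl
  otherEnd-incident _ (inj₂ _) = inj₁ refl

  otherEnd-≢ : ∀ {x} e (xe : Incident x e) → otherEnd e xe ≢ x
  otherEnd-≢ (_ , _ , u<w) (inj₁ refl) w≡u = Fin.<-irrefl (sym w≡u) u<w
  otherEnd-≢ (_ , _ , u<w) (inj₂ refl) u≡w = Fin.<-irrefl u≡w u<w

  otherEnd-unique : ∀ {x c} e (xe : Incident x e) → Incident c e → c ≢ x → c ≡ otherEnd e xe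
  otherEnd-unique _ (inj₁ refl) (inj₁ refl) c≢x = ⊥-elim (c≢x refl)
  otherEnd-unique _ (inj₁ refl) (inj₂ refl) _   = refl
  otherEnd-unique _ (inj₂ refl) (inj₁ refl) _   = refl
  otherEnd-unique _ (inj₂ refl) (inj₂ refl) c≢x = ⊥-elim (c≢x refl)

  isOriginal : V H → Bool
  isOriginal (inj₁ _) = true
  isOriginal (inj₂ _) = false

  adj⇒isOriginal-flips : ∀ w w' → adj H w w' ≡ true → isOriginal w' ≡ not (isOriginal w)
  adj⇒isOriginal-flips (inj₁ _) (inj₂ _) _ = refl
  adj⇒isOriginal-flips (inj₂ _) (inj₁ _) _ = refl

  subdivision-TwoNeighbours : ∀ e → TwoNeighbours H (inj₂ e)
  subdivision-TwoNeighbours e@((u , w) , _ , u<w) = record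
    { left       = inj₁ u
    ; right      = inj₁ w
    ; left≢right = λ u≡w → Fin.<-irrefl (Sum.inj₁-injective u≡w) u<w
    ; adj-left   = incident⇒adj e (inj₁ refl)
    ; adj-right  = incident⇒adj e (inj₂ refl)
    ; only       = λ { (inj₁ c) e~c → Data.Sum.map (cong inj₁) (cong inj₁) (adj⇒incident e e~c) }
    }

  original-TwoNeighbours : ∀ {x} → TwoNeighbours H (inj₁ x) → TwoNeighbours (toGraph G) x
  original-TwoNeighbours {x} t
    with neighbour-of-original (TwoNeighbours.adj-left t) | neighbour-of-original (TwoNeighbours.adj-right t)
  ... | e₁ , l≡e₁ , xe₁ | e₂ , r≡e₂ , xe₂ = record
    { left       = a
    ; right      = b
    ; left≢right = λ a≡b → left≢right t (trans l≡e₁ (trans (cong inj₂ (e₁≡e₂ a≡b)) (sym r≡e₂)))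
    ; adj-left   = incident⇒adjacent e₁ (otherEnd-≢ e₁ xe₁ ∘ sym) xe₁ (otherEnd-incident e₁ xe₁)
    ; adj-right  = incident⇒adjacent e₂ (otherEnd-≢ e₂ xe₂ ∘ sym) xe₂ (otherEnd-incident e₂ xe₂)
    ; only       = only′
    }
    where
    open TwoNeighbours
    a b : Fin n
    a = otherEnd e₁ xe₁
    b = otherEnd e₂ xe₂
    e₁≡e₂ : a ≡ b → e₁ ≡ e₂
    e₁≡e₂ a≡b = shared-endpoints⇒≡ e₁ e₂ (otherEnd-≢ e₁ xe₁ ∘ sym) xe₁ (otherEnd-incident e₁ xe₁)
                  xe₂ (subst (λ c → Incident c e₂) (sym a≡b) (otherEnd-incident e₂ xe₂))
    only′ : ∀ c → A x c ≡ true → c ≡ a ⊎ c ≡ b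
    only′ c xc with edgeThrough xc
    ... | e , xe , ce = Data.Sum.map (same-edge e₁ xe₁ l≡e₁) (same-edge e₂ xe₂ r≡e₂) (only t (inj₂ e) (incident⇒adj e xe))
      where
      same-edge : ∀ e' (xe' : Incident x e') {w} → w ≡ inj₂ e' → inj₂ e ≡ w → c ≡ otherEnd e' xe'
      same-edge e' xe' w≡e' e≡w = otherEnd-unique e' xe'
        (subst (Incident c) (Sum.inj₂-injective (trans e≡w w≡e')) ce) (adj⇒≢ (toGraph G) xc ∘ sym)

  nonOriginal-TwoNeighbours : ∀ w → isOriginal w ≡ false → TwoNeighbours H w
  nonOriginal-TwoNeighbours (inj₂ e) _ = subdivision-TwoNeighbours e

  isOriginal-along-walk : ∀ (σ : Automorphism H) {u w} → Walk G u w →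
                          isOriginal (Inverse.to (proj₁ σ) (inj₁ w)) ≡ isOriginal (Inverse.to (proj₁ σ) (inj₁ u))
  isOriginal-along-walk σ here = refl
  isOriginal-along-walk σ (step uw walk) with edgeThrough uw
  ... | e , ue , we = trans (isOriginal-along-walk σ walk) (Bool.not-injective (trans (sym (flips we)) (flips ue)))
    where
    open Inverse (proj₁ σ) using (to)
    flips : ∀ {x} → Incident x e → isOriginal (to (inj₂ e)) ≡ not (isOriginal (to (inj₁ x)))
    flips xe = adj⇒isOriginal-flips _ _ (trans (proj₂ σ _ _) (incident⇒adj e xe))

  KeepsSides : Automorphism H → Set
  KeepsSides (σ , _) = ∀ w → isOriginal (Inverse.to σ w) ≡ isOriginal w

  automorphism-keeps-sides : Connected G → ¬ IsCycle G → Fin n → (σ : Automorphism H) → KeepsSides σ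
  automorphism-keeps-sides conn not-cycle x₀ σ = keeps
    where
    open Inverse (proj₁ σ) using (to)
    original↦original : ∀ x → isOriginal (to (inj₁ x)) ≡ true
    original↦original x with isOriginal (to (inj₁ x₀)) in x₀↦
    ... | true  = trans (isOriginal-along-walk σ (conn x₀ x)) x₀↦
    ... | false = ⊥-elim (not-cycle (connected-two-regular⇒cycle G x₀ conn two))
      where
      two : ∀ y → TwoNeighbours (toGraph G) y
      two y = original-TwoNeighbours (Iso-reflects-TwoNeighbours σ
                (nonOriginal-TwoNeighbours (to (inj₁ y)) (trans (isOriginal-along-walk σ (conn x₀ y)) x₀↦)))
    keeps : ∀ w → isOriginal (to w) ≡ isOriginal w
    keeps (inj₁ x) = original↦original x
    keeps (inj₂ e@((u , _) , _)) =
      trans (adj⇒isOriginal-flips _ _ (trans (proj₂ σ _ _) (incident⇒adj e (inj₁ refl)))) (cong not (original↦original u))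

  KeepsSides-sym : ∀ σ → KeepsSides σ → KeepsSides (Iso-sym {H} {H} σ)
  KeepsSides-sym (σ , _) keeps w = trans (sym (keeps (Inverse.from σ w))) (cong isOriginal (Inverse.strictlyInverseˡ σ w))

  original : ∀ w → isOriginal w ≡ true → Fin n
  original (inj₁ x) _ = x

  original-≡ : ∀ w (o : isOriginal w ≡ true) → w ≡ inj₁ (original w o)
  original-≡ (inj₁ _) _ = refl

  subdivisionVertex : ∀ w → isOriginal w ≡ false → SubEdge G
  subdivisionVertex (inj₂ e) _ = e

  subdivisionVertex-≡ : ∀ w (s : isOriginal w ≡ false) → w ≡ inj₂ (subdivisionVertex w s)
  subdivisionVertex-≡ (inj₂ _) _ = refl

  module Restriction (σ : Automorphism H) (keeps : KeepsSides σ) where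
    open Inverse (proj₁ σ) using (to; from; strictlyInverseʳ)

    vertexMap : Fin n → Fin n
    vertexMap x = original (to (inj₁ x)) (keeps (inj₁ x))

    edgeMap : SubEdge G → SubEdge G
    edgeMap e = subdivisionVertex (to (inj₂ e)) (keeps (inj₂ e))

    to-inj₁ : ∀ x → to (inj₁ x) ≡ inj₁ (vertexMap x)
    to-inj₁ x = original-≡ _ (keeps (inj₁ x))

    to-inj₂ : ∀ e → to (inj₂ e) ≡ inj₂ (edgeMap e)
    to-inj₂ e = subdivisionVertex-≡ _ (keeps (inj₂ e))

    incident-map : ∀ {x} e → Incident x e → Incident (vertexMap x) (edgeMap e)
    incident-map {x} e xe = adj⇒incident (edgeMap e)
      (subst₂ (λ a b → adj H a b ≡ true) (to-inj₁ x) (to-inj₂ e) (trans (proj₂ σ _ _) (incident⇒adj e xe)))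

    vertexMap-injective : ∀ {x y} → vertexMap x ≡ vertexMap y → x ≡ y
    vertexMap-injective {x} {y} eq = Sum.inj₁-injective (begin
      inj₁ x                 ≡⟨ strictlyInverseʳ (inj₁ x) ⟨
      from (to (inj₁ x))     ≡⟨ cong from (trans (to-inj₁ x) (trans (cong inj₁ eq) (sym (to-inj₁ y)))) ⟩
      from (to (inj₁ y))     ≡⟨ strictlyInverseʳ (inj₁ y) ⟩
      inj₁ y                 ∎)
      where open ≡-Reasoning

    vertexMap-adj : ∀ {u w} → A u w ≡ true → A (vertexMap u) (vertexMap w) ≡ true
    vertexMap-adj uw with edgeThrough uw
    ... | e , ue , we = incident⇒adjacent (edgeMap e) (adj⇒≢ (toGraph G) uw ∘ vertexMap-injective)
                          (incident-map e ue) (incident-map e we)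

  restriction-inverse : ∀ σ τ (kσ : KeepsSides σ) (kτ : KeepsSides τ) →
                        (∀ w → Inverse.to (proj₁ τ) (Inverse.to (proj₁ σ) w) ≡ w) →
                        ∀ x → Restriction.vertexMap τ kτ (Restriction.vertexMap σ kσ x) ≡ x
  restriction-inverse σ τ kσ kτ τ∘σ≡id x = Sum.inj₁-injective (begin
    inj₁ (T.vertexMap (S.vertexMap x))       ≡⟨ T.to-inj₁ (S.vertexMap x) ⟨
    Inverse.to τ′ (inj₁ (S.vertexMap x))     ≡⟨ cong (Inverse.to τ′) (S.to-inj₁ x) ⟨
    Inverse.to τ′ (Inverse.to σ′ (inj₁ x))   ≡⟨ τ∘σ≡id (inj₁ x) ⟩
    inj₁ x                                   ∎)
    where
    open ≡-Reasoning
    module S = Restriction σ kσ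
    module T = Restriction τ kτ
    σ′ τ′ : V H ↔ V H
    σ′ = proj₁ σ
    τ′ = proj₁ τ

  inducedAutomorphism : (σ : Automorphism H) → KeepsSides σ → Automorphism (toGraph G)
  inducedAutomorphism σ keeps =
    mk↔ₛ′ S.vertexMap T.vertexMap S∘T T∘S , λ u w → true⇔true⇒≡ (reflect u w) S.vertexMap-adj
    where
    τ : Automorphism H
    τ = Iso-sym {H} {H} σ
    keeps⁻¹ : KeepsSides τ
    keeps⁻¹ = KeepsSides-sym σ keeps
    module S = Restriction σ keeps
    module T = Restriction τ keeps⁻¹
    S∘T : ∀ x → S.vertexMap (T.vertexMap x) ≡ x
    S∘T = restriction-inverse τ σ keeps⁻¹ keeps (Inverse.strictlyInverseˡ (proj₁ σ))
    T∘S : ∀ x → T.vertexMap (S.vertexMap x) ≡ x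
    T∘S = restriction-inverse σ τ keeps keeps⁻¹ (Inverse.strictlyInverseʳ (proj₁ σ))
    reflect : ∀ u w → A (S.vertexMap u) (S.vertexMap w) ≡ true → A u w ≡ true
    reflect u w uw = subst₂ (λ a b → A a b ≡ true) (T∘S u) (T∘S w) (T.vertexMap-adj uw)

module HalfLabelling {n} (G : FinGraph n) {d k} (ℓ : EdgeLabeling (toGraph G) d)
                     (code : Fin d → Fin k × Fin k) where
  open Subdivision G

  halfLabel : Fin n → SubEdge G → Fin k
  halfLabel x ((u , w) , _) with x Fin.≟ u
  ... | yes _ = proj₁ (code (lab ℓ u w))
  ... | no  _ = proj₂ (code (lab ℓ u w))

  halfLabel-first : ∀ {u w} (e : SubEdge G) → proj₁ e ≡ (u , w) → halfLabel u e ≡ proj₁ (code (lab ℓ u w))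
  halfLabel-first {u} _ refl with u Fin.≟ u
  ... | yes _   = refl
  ... | no  u≢u = ⊥-elim (u≢u refl)

  halfLabel-second : ∀ {u w} (e : SubEdge G) → proj₁ e ≡ (u , w) → halfLabel w e ≡ proj₂ (code (lab ℓ u w))
  halfLabel-second {u} {w} (_ , _ , u<w) refl with w Fin.≟ u
  ... | yes w≡u = ⊥-elim (Fin.<-irrefl (sym w≡u) u<w)
  ... | no  _   = refl

  halfLabels-SamePair : ∀ {x y} e → x ≢ y → Incident x e → Incident y e →
                        SamePair (halfLabel x e , halfLabel y e) (code (lab ℓ x y))
  halfLabels-SamePair e@((u , w) , uw , _) x≢y xe ye with incident-pair e x≢y xe ye
  ... | inj₁ refl = inj₁ (cong₂ _,_ (halfLabel-first e refl) (halfLabel-second e refl))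
  ... | inj₂ refl = inj₂ (trans (cong₂ _,_ (halfLabel-second e refl) (halfLabel-first e refl))
                                (cong (swap ∘ code) (lab-sym ℓ u w uw)))

  -- Pairs inside one side are never edges of H, so the last two values are junk; as Fin k may be
  -- empty they are still built from code.
  labH : V H → V H → Fin k
  labH (inj₁ x) (inj₂ e) = halfLabel x e
  labH (inj₂ e) (inj₁ x) = halfLabel x e
  labH (inj₁ x) (inj₁ _) = proj₁ (code (lab ℓ x x))
  labH (inj₂ e) (inj₂ _) = halfLabel (proj₁ (proj₁ e)) e

  halfLabelling : EdgeLabeling H k
  halfLabelling = record { lab = labH ; lab-sym = labH-sym }
    where
    labH-sym : ∀ u w → adj H u w ≡ true → labH u w ≡ labH w u
    labH-sym (inj₁ _) (inj₂ _) _ = refl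
    labH-sym (inj₂ _) (inj₁ _) _ = refl

  module _ (code-injective : ∀ {i j} → SamePair (code i) (code j) → i ≡ j) where

    inducedAutomorphism-preserves : ∀ σ keeps → Preserves H σ halfLabelling →
                                    Preserves (toGraph G) (inducedAutomorphism σ keeps) ℓ
    inducedAutomorphism-preserves σ keeps σ-preserves u w uw with edgeThrough uw
    ... | e , ue , we = code-injective (SamePair-trans
      (SamePair-sym (halfLabels-SamePair (edgeMap e) (u≢w ∘ vertexMap-injective) (incident-map e ue) (incident-map e we)))
      (subst (λ p → SamePair p (code (lab ℓ u w))) (sym (cong₂ _,_ (moved ue) (moved we)))
             (halfLabels-SamePair e u≢w ue we)))
      where
      open Restriction σ keeps
      u≢w : u ≢ w
      u≢w = adj⇒≢ (toGraph G) uw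
      moved : ∀ {x} → Incident x e → halfLabel (vertexMap x) (edgeMap e) ≡ halfLabel x e
      moved {x} xe = trans (sym (cong₂ labH (to-inj₁ x) (to-inj₂ e))) (σ-preserves (inj₁ x) (inj₂ e) (incident⇒adj e xe))

    halfLabelling-distinguishing : Connected G → ¬ IsCycle G → Fin n → Distinguishing (toGraph G) ℓ →
                                   Distinguishing H halfLabelling
    halfLabelling-distinguishing conn not-cycle x₀ ℓ-distinguishing σ σ-preserves = fixes
      where
      keeps : KeepsSides σ
      keeps = automorphism-keeps-sides conn not-cycle x₀ σ
      open Restriction σ keeps
      fixes-originals : ∀ x → vertexMap x ≡ x
      fixes-originals = ℓ-distinguishing (inducedAutomorphism σ keeps) (inducedAutomorphism-preserves σ keeps σ-preserves)
      fixed-incident : ∀ {x} e → Incident x e → Incident x (edgeMap e)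
      fixed-incident {x} e xe = subst (λ y → Incident y (edgeMap e)) (fixes-originals x) (incident-map e xe)
      fixes : ∀ w → Inverse.to (proj₁ σ) w ≡ w
      fixes (inj₁ x) = trans (to-inj₁ x) (cong inj₁ (fixes-originals x))
      fixes (inj₂ e@((_ , _) , _ , u<w)) = trans (to-inj₂ e) (cong inj₂
        (shared-endpoints⇒≡ (edgeMap e) e (Fin.<⇒≢ u<w) (fixed-incident e (inj₁ refl)) (fixed-incident e (inj₂ refl))
                            (inj₁ refl) (inj₂ refl)))

subdivision-distinguishable : ∀ {n} (G : FinGraph n) → Fin n → Connected G → ¬ IsCycle G →
                              ∀ {d k} → 2 * d ≤ k * suc k →
                              DistinguishableWith (toGraph G) d → DistinguishableWith (subdivide G) k
subdivision-distinguishable G x₀ conn not-cycle {d} {k} 2d≤k[k+1] (ℓ , ℓ-distinguishing) =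
  halfLabelling , halfLabelling-distinguishing pairCode-injective conn not-cycle x₀ ℓ-distinguishing
  where
  open PairCode {d} {k} 2d≤k[k+1]
  open HalfLabelling G ℓ pairCode

theorem4p2 : ∀ (n : ℕ) (G : FinGraph n) → 3 ≤ n → Connected G → (IsCycle G → ⊥) →
    ∀ (d k : ℕ) → DistIndexIs (toGraph G) d → IsCeilTri d k →
    DistIndexAtMost (subdivide G) k
theorem4p2 n G 3≤n conn not-cycle d k (distinguishable , _) (2d≤k[k+1] , _) =
  k , ℕ.≤-refl , subdivision-distinguishable G x₀ conn not-cycle {d} {k} 2d≤k[k+1] distinguishable
  where
  x₀ : Fin n
  x₀ = fromℕ< (ℕ.<-≤-trans (s≤s z≤n) 3≤n)
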